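{- Let $L$ be the graph with vertex set $\{x_i, y_i : i \in \mathbb{Z}\}$ and edges $\{x_i,y_i\}$, $\{x_i,y_{i+1}\}$, $\{x_{i+1},y_i\}$ for all $i\in\mathbb{Z}$ (the twisted square ladder, infinite in both directions). Fix the configuration $T=\{y_i : i\in\mathbb{Z}\}$. Let $\mathcal{C}_+$ be the set of configurations $\chi$ of $L$ (sets of vertices containing no edge) such that the set of occupied columns $\Omega(\chi)$ satisfies $\Omega(\chi)\supseteq \mathbb{Z}_{<0}$, $\Omega(\chi)\cap\mathbb{Z}_{\ge 0}$ is finite, and $\chi$ agrees with $T$ on all sufficiently negative columns. Then $$F_+(t,q):=\sum_{\chi\in\mathcal{C}_+} t^{C(\Omega(\chi))}q^{U(\Omega(\chi))}=\sum_{n=0}^{\infty}\frac{(q)_n^+}{(q)_n}\,q^{n(n-1)/2}\,t^n,$$ where $(q)_n^+=(1+q)(1+q^2)\cdots(1+q^n)$ and $(q)_n=(1-q)(1-q^2)\cdots(1-q^n)$.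
   Context: A configuration of a graph is an arrangement of particles at vertices, at most one per vertex, such that no two particles occupy vertices joined by an edge (i.e. an independent set of vertices). The vertices $x_i,y_i$ form column $i$; since $\{x_i,y_i\}$ is an edge, each column contains at most one particle, and $\Omega(\chi)\subset\mathbb{Z}$ denotes the set of indices of occupied columns. For a set $\Omega\subset\mathbb{Z}$ with $\Omega_e=\Omega\cap\mathbb{Z}_{\ge0}$ and $\Omega_p=\mathbb{Z}_{<0}\setminus\Omega$ finite (a Dirac set), the charge is $C(\Omega)=|\Omega_e|-|\Omega_p|$ and the energy is $U(\Omega)=\sum_{\alpha\in\Omega_e\cup\Omega_p}|\alpha|$. In $\mathcal{C}_+$ one has $\Omega_p=\emptyset$. -}

module Defs where

open import Data.Bool using (Bool; true; false; _∨_; if_then_else_)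
open import Data.Nat using (ℕ; zero; suc; _+_; _*_; _∸_; _≤_; _≡ᵇ_)
open import Data.Nat.DivMod using (_%_; _/_)
open import Data.Integer as ℤ using (ℤ; +_; -[1+_])
open import Data.Fin using (Fin)
open import Data.Product using (Σ; _×_)
open import Relation.Binary.PropositionalEquality using (_≡_)
open import Relation.Nullary using (¬_)

data V : Set where
  X : ℤ → V
  Y : ℤ → V

data Edge : V → V → Set where
  col : (i : ℤ) → Edge (X i) (Y i)
  xy  : (i : ℤ) → Edge (X i) (Y (i ℤ.+ + 1))
  yx  : (i : ℤ) → Edge (X (i ℤ.+ + 1)) (Y i)

Config : Set
Config = V → Bool

Independent : Config → Set
Independent χ = ∀ u v → Edge u v → ¬ (χ u ≡ true × χ v ≡ true)

Occ : Config → ℤ → Bool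
Occ χ i = χ (X i) ∨ χ (Y i)

Cplus : Config → Set
Cplus χ =
  Independent χ
  × (∀ i → i ℤ.< + 0 → Occ χ i ≡ true)
  × Σ ℕ (λ N → ∀ k → N ≤ k → Occ χ (+ k) ≡ false)
  × Σ ℤ (λ M → ∀ i → i ℤ.≤ M → χ (X i) ≡ false × χ (Y i) ≡ true)

sumTo : (ℕ → ℕ) → ℕ → ℕ
sumTo h zero    = 0
sumTo h (suc n) = sumTo h n + h n

ind : Bool → ℕ
ind true  = 1
ind false = 0

cntUpTo : Config → ℕ → ℕ
cntUpTo χ = sumTo (λ k → ind (Occ χ (+ k)))

enUpTo : Config → ℕ → ℕ
enUpTo χ = sumTo (λ k → k * ind (Occ χ (+ k)))

-- C(Ω(χ)) = n and U(Ω(χ)) = m   (for χ ∈ C₊, where Ω_p = ∅).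
ChargeEnergy : Config → ℕ → ℕ → Set
ChargeEnergy χ n m =
  Σ ℕ (λ N → (∀ k → N ≤ k → Occ χ (+ k) ≡ false)
            × cntUpTo χ N ≡ n × enUpTo χ N ≡ m)

_≈_ : Config → Config → Set
χ ≈ χ' = ∀ v → χ v ≡ χ' v

HasCount : (Config → Set) → ℕ → Set
HasCount P c =
  Σ (Fin c → Config) λ e →
    (∀ i → P (e i))
    × (∀ i j → e i ≈ e j → i ≡ j)
    × (∀ χ → P χ → Σ (Fin c) λ i → χ ≈ e i)

Series : Set
Series = ℕ → ℕ

_⊛_ : Series → Series → Series
(f ⊛ g) m = sumTo (λ i → f i * g (m ∸ i)) (suc m)

one : Series
one m = if m ≡ᵇ 0 then 1 else 0

mono : ℕ → Series
mono d m = if m ≡ᵇ d then 1 else 0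

onePlusQ : ℕ → Series
onePlusQ k m = one m + mono (suc k) m

-- 1 / (1 - q^(k+1)) = Σ_j q^((k+1) j)
invOneMinusQ : ℕ → Series
invOneMinusQ k m = if (m % suc k) ≡ᵇ 0 then 1 else 0

qPochPlus : ℕ → Series
qPochPlus zero    = one
qPochPlus (suc n) = qPochPlus n ⊛ onePlusQ n

qPochInv : ℕ → Series
qPochInv zero    = one
qPochInv (suc n) = qPochInv n ⊛ invOneMinusQ n

rhsCoeff : ℕ → ℕ → ℕ
rhsCoeff n m = (mono (n * (n ∸ 1) / 2) ⊛ (qPochPlus n ⊛ qPochInv n)) m

-- A configuration in C₊ agrees with T on every negative column, so it is determined by its columns
-- 0, 1, 2, …, each vacant or holding one particle on row x or row y; independence says exactly that
-- x₀ is vacant and that particles in adjacent columns lie on the same row. Index the n particles from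
-- the right by k = 0, …, n − 1. Particle k follows a run of g_k vacant columns, and its row may differ
-- from that of its left neighbour (row y for the leftmost) only if g_k ≥ 1. Writing g_k = b_k + j_k with
-- b_k ∈ {0, 1} recording a change of row, the pairs (b_k, j_k) are arbitrary, and as the run before
-- particle k shifts the k + 1 particles from it on, U = n(n − 1)/2 + Σ_k (k + 1)(b_k + j_k). The
-- weights (k + 1) b_k and (k + 1) j_k have generating series 1 + q^(k+1) and 1/(1 − q^(k+1)).
module Submission where

open import Defs
open import Data.Bool using (Bool; true; false; T; _∨_)
open import Data.Bool.Properties using (∨-conicalˡ; ∨-conicalʳ)
open import Data.Empty using (⊥; ⊥-elim)
open import Data.Fin using (Fin; zero)
open import Data.Fin.Properties using (+↔⊎; *↔×)
open import Data.Integer as ℤ using (ℤ; +_; -[1+_]; +<+; -<+; -≤-; -≤+)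
open import Data.List using (List; []; _∷_; _++_; replicate; length; applyUpTo)
open import Data.List.Properties using (length-applyUpTo)
open import Data.Nat using (ℕ; zero; suc; _+_; _*_; _∸_; _≤_; _<_; s≤s; _≡ᵇ_)
open import Data.Nat.DivMod using (_%_; _/_; m≡m%n+[m/n]*n; m*n/n≡m; m*n%n≡0; +-distrib-/-∣ʳ)
open import Data.Nat.Divisibility using (n∣m*n)
open import Data.Nat.Properties
open import Data.Nat.Tactic.RingSolver using (solve-∀)
open import Data.Product as Product using (Σ; _×_; _,_; proj₁; proj₂)
open import Data.Sum using (_⊎_; inj₁; inj₂; [_,_])
open import Data.Unit using (⊤; tt)
open import Function using (_∘_; id)
open import Function.Bundles using (_↔_; Inverse)
open import Relation.Binary.PropositionalEquality hiding ([_])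
open import Relation.Nullary using (¬_; yes; no)

-- Counting up to an equivalence

IsEnumeration : {I A : Set} → (A → A → Set) → (A → Set) → (I → A) → Set
IsEnumeration {I} {A} _∼_ P e =
  (∀ i → P (e i)) × (∀ i j → e i ∼ e j → i ≡ j) × (∀ a → P a → Σ I λ i → a ∼ e i)

-- HasCount P c is Counted _≈_ P c.
Counted : {A : Set} → (A → A → Set) → (A → Set) → ℕ → Set
Counted {A} _∼_ P c = Σ (Fin c → A) (IsEnumeration _∼_ P)

Counted-map : {A B : Set} {_∼_ : B → B → Set} {P : A → Set} {Q : B → Set} {c : ℕ}
  (f : A → B) → (∀ a → P a → Q (f a)) → (∀ a a' → f a ∼ f a' → a ≡ a') →
  (∀ b → Q b → Σ A λ a → P a × b ∼ f a) → Counted _≡_ P c → Counted _∼_ Q c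
Counted-map {_∼_ = _∼_} {Q = Q} {c} f f-Q f-injective f-onto (e , e-P , e-injective , e-onto) =
  f ∘ e , (λ i → f-Q _ (e-P i)) , (λ i j eq → e-injective i j (f-injective _ _ eq)) , onto
  where
  onto : ∀ b → Q b → Σ (Fin c) λ i → b ∼ f (e i)
  onto b qb with f-onto b qb
  ... | a , pa , b∼fa with e-onto a pa
  ...   | i , refl = i , b∼fa

Counted-⇔ : {A : Set} {P Q : A → Set} {c : ℕ} →
  (∀ a → P a → Q a) → (∀ a → Q a → P a) → Counted _≡_ P c → Counted _≡_ Q c
Counted-⇔ P⇒Q Q⇒P = Counted-map id P⇒Q (λ _ _ → id) (λ a qa → a , Q⇒P a qa , refl)

Counted-∅ : {A : Set} {P : A → Set} → (∀ a → ¬ P a) → Counted _≡_ P 0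
Counted-∅ ¬P = (λ ()) , (λ ()) , (λ ()) , λ a pa → ⊥-elim (¬P a pa)

Counted-singleton : {A : Set} {P : A → Set} (a : A) → P a → (∀ b → P b → b ≡ a) → Counted _≡_ P 1
Counted-singleton a pa unique =
  (λ _ → a) , (λ _ → pa) , (λ { zero zero _ → refl }) , λ b pb → zero , unique b pb

enumeration-reindex : {I J A : Set} {_∼_ : A → A → Set} {P : A → Set} {e : I → A}
  (σ : J ↔ I) → IsEnumeration _∼_ P e → IsEnumeration _∼_ P (e ∘ Inverse.to σ)
enumeration-reindex {J = J} {_∼_ = _∼_} {P} {e} σ (e-P , e-injective , e-onto) =
  e-P ∘ to , (λ i j eq → to-injective (e-injective _ _ eq)) , onto
  where
  open Inverse σ
  to-injective : ∀ {i j} → to i ≡ to j → i ≡ j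
  to-injective {i} {j} eq = trans (sym (strictlyInverseʳ i)) (trans (cong from eq) (strictlyInverseʳ j))
  onto : ∀ a → P a → Σ J λ j → a ∼ e (to j)
  onto a pa with e-onto a pa
  ... | i , a∼ei = from i , subst (λ k → a ∼ e k) (sym (strictlyInverseˡ i)) a∼ei

enumeration-⊎ : {I J A : Set} {P Q : A → Set} {e₁ : I → A} {e₂ : J → A} →
  (∀ a → P a → Q a → ⊥) → IsEnumeration _≡_ P e₁ → IsEnumeration _≡_ Q e₂ →
  IsEnumeration _≡_ (λ a → P a ⊎ Q a) [ e₁ , e₂ ]
enumeration-⊎ {I} {J} {P = P} {Q} {e₁} {e₂} disjoint (P₁ , injective₁ , onto₁) (Q₂ , injective₂ , onto₂) =
  [ inj₁ ∘ P₁ , inj₂ ∘ Q₂ ] , injective , onto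
  where
  injective : ∀ s t → [ e₁ , e₂ ] s ≡ [ e₁ , e₂ ] t → s ≡ t
  injective (inj₁ i) (inj₁ j) eq = cong inj₁ (injective₁ i j eq)
  injective (inj₁ i) (inj₂ j) eq = ⊥-elim (disjoint _ (P₁ i) (subst Q (sym eq) (Q₂ j)))
  injective (inj₂ i) (inj₁ j) eq = ⊥-elim (disjoint _ (P₁ j) (subst Q eq (Q₂ i)))
  injective (inj₂ i) (inj₂ j) eq = cong inj₂ (injective₂ i j eq)
  onto : ∀ a → P a ⊎ Q a → Σ (I ⊎ J) λ s → a ≡ [ e₁ , e₂ ] s
  onto a (inj₁ pa) = Product.map inj₁ id (onto₁ a pa)
  onto a (inj₂ qa) = Product.map inj₂ id (onto₂ a qa)

enumeration-× : {I J A B : Set} {P : A → Set} {Q : B → Set} {e₁ : I → A} {e₂ : J → B} →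
  IsEnumeration _≡_ P e₁ → IsEnumeration _≡_ Q e₂ →
  IsEnumeration _≡_ (λ x → P (proj₁ x) × Q (proj₂ x)) (Product.map e₁ e₂)
enumeration-× (P₁ , injective₁ , onto₁) (Q₂ , injective₂ , onto₂) =
  (λ x → P₁ (proj₁ x) , Q₂ (proj₂ x)) ,
  (λ x y eq → cong₂ _,_ (injective₁ _ _ (cong proj₁ eq)) (injective₂ _ _ (cong proj₂ eq))) ,
  λ { (a , b) (pa , qb) → let (i , a≡) = onto₁ a pa ; (j , b≡) = onto₂ b qb in (i , j) , cong₂ _,_ a≡ b≡ }

Counted-⊎ : {A : Set} {P Q : A → Set} {c d : ℕ} → (∀ a → P a → Q a → ⊥) →
  Counted _≡_ P c → Counted _≡_ Q d → Counted _≡_ (λ a → P a ⊎ Q a) (c + d)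
Counted-⊎ disjoint (e₁ , enum₁) (e₂ , enum₂) = _ , enumeration-reindex {_∼_ = _≡_} +↔⊎ (enumeration-⊎ disjoint enum₁ enum₂)

Counted-× : {A B : Set} {P : A → Set} {Q : B → Set} {c d : ℕ} →
  Counted _≡_ P c → Counted _≡_ Q d → Counted _≡_ (λ x → P (proj₁ x) × Q (proj₂ x)) (c * d)
Counted-× (e₁ , enum₁) (e₂ , enum₂) = _ , enumeration-reindex {_∼_ = _≡_} *↔× (enumeration-× enum₁ enum₂)

Counted-⋃< : {A : Set} (P : ℕ → A → Set) {h : ℕ → ℕ} → (∀ i j a → P i a → P j a → i ≡ j) →
  (∀ i → Counted _≡_ (P i) (h i)) → ∀ K → Counted _≡_ (λ a → Σ ℕ λ i → i < K × P i a) (sumTo h K)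
Counted-⋃< P disjoint counted zero = Counted-∅ λ { a (i , () , _) }
Counted-⋃< P disjoint counted (suc K) =
  Counted-⇔ (λ { a (inj₁ (i , i<K , p)) → i , m≤n⇒m≤1+n i<K , p ; a (inj₂ p) → K , ≤-refl , p })
            (λ { a (i , s≤s i≤K , p) → last-or-earlier i (m≤n⇒m<n∨m≡n i≤K) p })
            (Counted-⊎ (λ { a (i , i<K , p) q → <-irrefl (disjoint i K a p q) i<K })
                       (Counted-⋃< P disjoint counted K) (counted K))
  where
  last-or-earlier : ∀ {a} i → i < K ⊎ i ≡ K → P i a → (Σ ℕ λ i → i < K × P i a) ⊎ P K a
  last-or-earlier i (inj₁ i<K) p = inj₁ (i , i<K , p)
  last-or-earlier i (inj₂ refl) p = inj₂ p

-- Generating series of weighted types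

HasSeries : {A : Set} → (A → ℕ) → Series → Set
HasSeries w f = ∀ m → Counted _≡_ (λ a → w a ≡ m) (f m)

HasSeries-⊛ : {A B : Set} {w : A → ℕ} {v : B → ℕ} {f g : Series} →
  HasSeries w f → HasSeries v g → HasSeries (λ x → w (proj₁ x) + v (proj₂ x)) (f ⊛ g)
HasSeries-⊛ {w = w} {v} series-w series-v m =
  Counted-⇔ (λ { x (i , s≤s i≤m , refl , v≡) → trans (cong (_+_ i) v≡) (m+[n∸m]≡n i≤m) })
            (λ { x refl → w (proj₁ x) , s≤s (m≤m+n _ _) , refl , sym (m+n∸m≡n (w (proj₁ x)) (v (proj₂ x))) })
            (Counted-⋃< (λ i x → w (proj₁ x) ≡ i × v (proj₂ x) ≡ m ∸ i)
                        (λ { i j x (refl , _) (refl , _) → refl })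
                        (λ i → Counted-× (series-w i) (series-v (m ∸ i))) (suc m))

HasSeries-mono : ∀ d → HasSeries {⊤} (λ _ → d) (mono d)
HasSeries-mono d m with m ≡ᵇ d in eq
... | true  = Counted-singleton tt (sym (≡ᵇ⇒≡ m d (subst T (sym eq) tt))) (λ _ _ → refl)
... | false = Counted-∅ λ _ d≡m → subst T eq (≡⇒≡ᵇ m d (sym d≡m))

switchWeight : ℕ → Bool → ℕ
switchWeight k false = 0
switchWeight k true  = suc k

HasSeries-onePlusQ : ∀ k → HasSeries (switchWeight k) (onePlusQ k)
HasSeries-onePlusQ k m =
  Counted-⇔ (λ { _ (inj₁ (refl , e)) → e ; _ (inj₂ (refl , e)) → e })
            (λ { false e → inj₁ (refl , e) ; true e → inj₂ (refl , e) })
            (Counted-⊎ (λ { _ (refl , _) (() , _) }) (only false (HasSeries-mono 0 m)) (only true (HasSeries-mono (suc k) m)))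
  where
  only : ∀ {P c} b → Counted {⊤} _≡_ (λ _ → P) c → Counted _≡_ (λ b' → b' ≡ b × P) c
  only b = Counted-map {_∼_ = _≡_} (λ _ → b) (λ _ p → refl , p) (λ _ _ _ → refl) (λ { _ (refl , p) → tt , p , refl })

stretchWeight : ℕ → ℕ → ℕ
stretchWeight k j = suc k * j

HasSeries-invOneMinusQ : ∀ k → HasSeries (stretchWeight k) (invOneMinusQ k)
HasSeries-invOneMinusQ k m with m % suc k ≡ᵇ 0 in eq
... | true  = Counted-singleton (m / suc k) quotient-exact quotient-unique
  where
  quotient-exact : suc k * (m / suc k) ≡ m
  quotient-exact = begin
    suc k * (m / suc k)          ≡⟨ *-comm (suc k) (m / suc k) ⟩
    m / suc k * suc k            ≡⟨ cong (_+ m / suc k * suc k) (sym (≡ᵇ⇒≡ _ 0 (subst T (sym eq) tt))) ⟩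
    m % suc k + m / suc k * suc k ≡⟨ sym (m≡m%n+[m/n]*n m (suc k)) ⟩
    m                            ∎
    where open ≡-Reasoning
  quotient-unique : ∀ j → suc k * j ≡ m → j ≡ m / suc k
  quotient-unique j e = trans (sym (m*n/n≡m j (suc k))) (cong (_/ suc k) (trans (*-comm j (suc k)) e))
... | false = Counted-∅ λ j e → subst T eq (≡⇒≡ᵇ _ 0
  (trans (cong (_% suc k) (trans (sym e) (*-comm (suc k) j))) (m*n%n≡0 j (suc k))))

Tuple : Set → ℕ → Set
Tuple A zero    = ⊤
Tuple A (suc n) = Tuple A n × A

tupleWeight : {A : Set} → (ℕ → A → ℕ) → ∀ n → Tuple A n → ℕ
tupleWeight w zero    _       = 0
tupleWeight w (suc n) (t , a) = tupleWeight w n t + w n a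

HasSeries-qPochPlus : ∀ n → HasSeries (tupleWeight switchWeight n) (qPochPlus n)
HasSeries-qPochPlus zero    = HasSeries-mono 0
HasSeries-qPochPlus (suc n) = HasSeries-⊛ (HasSeries-qPochPlus n) (HasSeries-onePlusQ n)

HasSeries-qPochInv : ∀ n → HasSeries (tupleWeight stretchWeight n) (qPochInv n)
HasSeries-qPochInv zero    = HasSeries-mono 0
HasSeries-qPochInv (suc n) = HasSeries-⊛ (HasSeries-qPochInv n) (HasSeries-invOneMinusQ n)

Gaps : ℕ → Set
Gaps n = Tuple Bool n × Tuple ℕ n

gapsWeight : ∀ n → Gaps n → ℕ
gapsWeight n (bs , js) = tupleWeight switchWeight n bs + tupleWeight stretchWeight n js

triangle : ℕ → ℕ
triangle n = n * (n ∸ 1) / 2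

HasSeries-rhsCoeff : ∀ n → HasSeries {⊤ × Gaps n} (λ x → triangle n + gapsWeight n (proj₂ x)) (rhsCoeff n)
HasSeries-rhsCoeff n = HasSeries-⊛ (HasSeries-mono (triangle n)) (HasSeries-⊛ (HasSeries-qPochPlus n) (HasSeries-qPochInv n))

triangle-suc : ∀ n → triangle (suc n) ≡ triangle n + n
triangle-suc n = begin
  suc n * n / 2                 ≡⟨ cong (_/ 2) (square-split n) ⟩
  (n * (n ∸ 1) + n * 2) / 2     ≡⟨ +-distrib-/-∣ʳ (n * (n ∸ 1)) (n∣m*n n) ⟩
  n * (n ∸ 1) / 2 + n * 2 / 2   ≡⟨ cong (_+_ (triangle n)) (m*n/n≡m n 2) ⟩
  triangle n + n                ∎
  where
  open ≡-Reasoning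
  square-split : ∀ n → suc n * n ≡ n * (n ∸ 1) + n * 2
  square-split zero    = refl
  square-split (suc n) = shape n
    where
    shape : ∀ n → suc (suc n) * suc n ≡ suc n * n + suc n * 2
    shape = solve-∀

-- Words of cells

data Row : Set where
  rowX rowY : Row

switch : Row → Row
switch rowX = rowY
switch rowY = rowX

switch-≢ : ∀ r → switch r ≢ r
switch-≢ rowX ()
switch-≢ rowY ()

data Cell : Set where
  vacant   : Cell
  occupied : Row → Cell

-- x_i y_{i+1} and y_i x_{i+1} are edges, so particles in adjacent columns share their row.
Compatible : Cell → Cell → Set
Compatible (occupied r) (occupied r') = r ≡ r'
Compatible (occupied r) vacant        = ⊤
Compatible vacant       _             = ⊤

Compatible-vacant : ∀ c → Compatible c vacant
Compatible-vacant vacant       = tt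
Compatible-vacant (occupied r) = tt

Chain : Cell → List Cell → Set
Chain c []      = ⊤
Chain c (d ∷ w) = Compatible c d × Chain d w

cellAt : List Cell → ℕ → Cell
cellAt []      k       = vacant
cellAt (c ∷ w) zero    = c
cellAt (c ∷ w) (suc k) = cellAt w k

occupancy : Cell → ℕ
occupancy vacant       = 0
occupancy (occupied _) = 1

particles : List Cell → ℕ
particles []      = 0
particles (c ∷ w) = occupancy c + particles w

-- Σ_k k · occupancy (cellAt w k): shifting a word one column right adds one per particle.
energy : List Cell → ℕ
energy []      = 0
energy (c ∷ w) = particles w + energy w

gap : Bool → ℕ → ℕ
gap false j = j
gap true  j = suc j

nextRow : Row → Bool → Row
nextRow r false = r
nextRow r true  = switch r

block : ℕ → Row → List Cell → List Cell
block g r w = replicate g vacant ++ occupied r ∷ w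

-- The leftmost particle comes from the last entry of the tuples; a switch of row costs one extra vacant column.
encode : ∀ n → Row → Gaps n → List Cell
encode zero    r _                       = []
encode (suc n) r ((bs , b) , (js , j)) =
  block (gap b j) (nextRow r b) (encode n (nextRow r b) (bs , js))

particles-block : ∀ g r w → particles (block g r w) ≡ suc (particles w)
particles-block zero    r w = refl
particles-block (suc g) r w = particles-block g r w

energy-block : ∀ g r w → energy (block g r w) ≡ g * suc (particles w) + (particles w + energy w)
energy-block zero    r w = refl
energy-block (suc g) r w = begin
  particles (block g r w) + energy (block g r w)
    ≡⟨ cong₂ _+_ (particles-block g r w) (energy-block g r w) ⟩
  suc (particles w) + (g * suc (particles w) + (particles w + energy w))
    ≡⟨ sym (+-assoc (suc (particles w)) _ _) ⟩
  suc g * suc (particles w) + (particles w + energy w) ∎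
  where open ≡-Reasoning

particles-encode : ∀ n r v → particles (encode n r v) ≡ n
particles-encode zero    r v = refl
particles-encode (suc n) r ((bs , b) , (js , j)) =
  trans (particles-block (gap b j) _ _) (cong suc (particles-encode n _ _))

gap-weight : ∀ k b j → switchWeight k b + stretchWeight k j ≡ gap b j * suc k
gap-weight k false j = *-comm (suc k) j
gap-weight k true  j = cong (_+_ (suc k)) (*-comm (suc k) j)

energy-encode : ∀ n r v → energy (encode n r v) ≡ triangle n + gapsWeight n v
energy-encode zero    r v = refl
energy-encode (suc n) r ((bs , b) , (js , j)) = begin
  energy (block (gap b j) (nextRow r b) w)
    ≡⟨ energy-block (gap b j) _ w ⟩
  gap b j * suc (particles w) + (particles w + energy w)
    ≡⟨ cong₂ (λ p e → gap b j * suc p + (p + e)) (particles-encode n _ _) (energy-encode n _ _) ⟩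
  gap b j * suc n + (n + (triangle n + (flips + stretches)))
    ≡⟨ cong (_+ (n + (triangle n + (flips + stretches)))) (sym (gap-weight n b j)) ⟩
  switchWeight n b + stretchWeight n j + (n + (triangle n + (flips + stretches)))
    ≡⟨ regroup (switchWeight n b) (stretchWeight n j) n (triangle n) flips stretches ⟩
  (triangle n + n) + (flips + switchWeight n b + (stretches + stretchWeight n j))
    ≡⟨ cong (_+ (flips + switchWeight n b + (stretches + stretchWeight n j))) (sym (triangle-suc n)) ⟩
  triangle (suc n) + (flips + switchWeight n b + (stretches + stretchWeight n j)) ∎
  where
  open ≡-Reasoning
  w : List Cell
  w = encode n (nextRow r b) (bs , js)
  flips stretches : ℕ
  flips = tupleWeight switchWeight n bs
  stretches = tupleWeight stretchWeight n js
  regroup : ∀ a b c d e f → a + b + (c + (d + (e + f))) ≡ (d + c) + (e + a + (f + b))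
  regroup = solve-∀

Chain-block : ∀ c g r w → (g ≡ 0 → Compatible c (occupied r)) → Chain (occupied r) w → Chain c (block g r w)
Chain-block c zero    r w compatible chain = compatible refl , chain
Chain-block c (suc g) r w compatible chain = Compatible-vacant c , Chain-block vacant g r w (λ _ → tt) chain

Chain-encode : ∀ n r v → Chain (occupied r) (encode n r v)
Chain-encode zero    r v = tt
Chain-encode (suc n) r ((bs , b) , (js , j)) =
  Chain-block (occupied r) (gap b j) (nextRow r b) _ (no-switch b) (Chain-encode n _ _)
  where
  no-switch : ∀ b → gap b j ≡ 0 → r ≡ nextRow r b
  no-switch false _ = refl
  no-switch true  ()

occupied-injective : ∀ {r r'} → occupied r ≡ occupied r' → r ≡ r'
occupied-injective refl = refl

block-injective : ∀ g g' r r' w w' → cellAt (block g r w) ≗ cellAt (block g' r' w') →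
  g ≡ g' × r ≡ r' × cellAt w ≗ cellAt w'
block-injective zero    zero     r r' w w' eq = refl , occupied-injective (eq 0) , eq ∘ suc
block-injective zero    (suc g') r r' w w' eq with () ← eq 0
block-injective (suc g) zero     r r' w w' eq with () ← eq 0
block-injective (suc g) (suc g') r r' w w' eq
  with refl , refl , rest ← block-injective g g' r r' w w' (eq ∘ suc) = refl , refl , rest

nextRow-injective : ∀ r b b' → nextRow r b ≡ nextRow r b' → b ≡ b'
nextRow-injective r false false eq = refl
nextRow-injective r false true  eq = ⊥-elim (switch-≢ r (sym eq))
nextRow-injective r true  false eq = ⊥-elim (switch-≢ r eq)
nextRow-injective r true  true  eq = refl

gap-injective : ∀ b j j' → gap b j ≡ gap b j' → j ≡ j'
gap-injective false j j' eq = eq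
gap-injective true  j j' eq = suc-injective eq

encode-injective : ∀ n r v v' → cellAt (encode n r v) ≗ cellAt (encode n r v') → v ≡ v'
encode-injective zero    r (tt , tt) (tt , tt) eq = refl
encode-injective (suc n) r ((bs , b) , (js , j)) ((bs' , b') , (js' , j')) eq
  with gaps≡ , rows≡ , rest ← block-injective (gap b j) (gap b' j') _ _ _ _ eq
  with refl ← nextRow-injective r b b' rows≡
  with refl ← gap-injective b j j' gaps≡
  with refl ← encode-injective n (nextRow r b) (bs , js) (bs' , js') rest = refl

empty-word : ∀ w → particles w ≡ 0 → cellAt [] ≗ cellAt w × energy w ≡ 0
empty-word []             _  = (λ _ → refl) , refl
empty-word (vacant ∷ w)   p≡0 with vacant≗ , e≡0 ← empty-word w p≡0 =
  (λ { zero → refl ; (suc k) → vacant≗ k }) , trans (cong (_+ energy w) p≡0) e≡0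
empty-word (occupied r ∷ w) ()

first-particle : ∀ n w → particles w ≡ suc n → Σ ℕ λ g → Σ Row λ r → Σ (List Cell) λ w' → w ≡ block g r w'
first-particle n []               ()
first-particle n (vacant ∷ w)     p≡ with g , r , w' , refl ← first-particle n w p≡ = suc g , r , w' , refl
first-particle n (occupied r ∷ w) p≡ = 0 , r , w , refl

Chain-block⁻¹ : ∀ c g r w → Chain c (block g r w) → (g ≡ 0 → Compatible c (occupied r)) × Chain (occupied r) w
Chain-block⁻¹ c zero    r w (compatible , chain) = (λ _ → compatible) , chain
Chain-block⁻¹ c (suc g) r w (_ , chain)          = (λ ()) , proj₂ (Chain-block⁻¹ vacant g r w chain)

block-cong : ∀ g r {w w'} → cellAt w ≗ cellAt w' → cellAt (block g r w) ≗ cellAt (block g r w')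
block-cong zero    r eq zero    = refl
block-cong zero    r eq (suc k) = eq k
block-cong (suc g) r eq zero    = refl
block-cong (suc g) r eq (suc k) = block-cong g r eq k

gap-choice : ∀ r g r' → (g ≡ 0 → Compatible (occupied r) (occupied r')) →
  Σ Bool λ b → Σ ℕ λ j → gap b j ≡ g × nextRow r b ≡ r'
gap-choice rowX g       rowX _          = false , g , refl , refl
gap-choice rowY g       rowY _          = false , g , refl , refl
gap-choice rowX zero    rowY compatible with () ← compatible refl
gap-choice rowY zero    rowX compatible with () ← compatible refl
gap-choice rowX (suc g) rowY _          = true , g , refl , refl
gap-choice rowY (suc g) rowX _          = true , g , refl , refl

energy-block-cong : ∀ g r {w w'} → particles w ≡ particles w' → energy w ≡ energy w' →
  energy (block g r w) ≡ energy (block g r w')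
energy-block-cong g r {w} {w'} p≡ e≡ = begin
  energy (block g r w)                                 ≡⟨ energy-block g r w ⟩
  g * suc (particles w) + (particles w + energy w)     ≡⟨ cong₂ (λ p e → g * suc p + (p + e)) p≡ e≡ ⟩
  g * suc (particles w') + (particles w' + energy w')  ≡⟨ sym (energy-block g r w') ⟩
  energy (block g r w')                                ∎
  where open ≡-Reasoning

encode-onto : ∀ n r w → Chain (occupied r) w → particles w ≡ n →
  Σ (Gaps n) λ v → cellAt (encode n r v) ≗ cellAt w × energy w ≡ triangle n + gapsWeight n v
encode-onto zero    r w chain p≡ with vacant≗ , e≡0 ← empty-word w p≡ = (tt , tt) , vacant≗ , e≡0
encode-onto (suc n) r w chain p≡
  with g , r' , w' , refl ← first-particle n w p≡
  with compatible , chain' ← Chain-block⁻¹ (occupied r) g r' w' chain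
  with b , j , refl , refl ← gap-choice r g r' compatible
  with p'≡ ← suc-injective (trans (sym (particles-block (gap b j) (nextRow r b) w')) p≡)
  with (bs , js) , w'≗ , e≡ ← encode-onto n (nextRow r b) w' chain' p'≡ =
    v , block-cong (gap b j) (nextRow r b) w'≗ ,
    trans (energy-block-cong (gap b j) (nextRow r b) (trans p'≡ (sym (particles-encode n _ _)))
                                                     (trans e≡ (sym (energy-encode n _ _))))
          (energy-encode (suc n) r v)
  where
  v : Gaps (suc n)
  v = ((bs , b) , (js , j))

-- Configurations as words

sumTo-cong : ∀ {f g} N → (∀ k → f k ≡ g k) → sumTo f N ≡ sumTo g N
sumTo-cong zero    f≗g = refl
sumTo-cong (suc N) f≗g = cong₂ _+_ (sumTo-cong N f≗g) (f≗g N)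

sumTo-suc : ∀ f N → sumTo f (suc N) ≡ f 0 + sumTo (f ∘ suc) N
sumTo-suc f zero    = +-comm 0 (f 0)
sumTo-suc f (suc N) = trans (cong (_+ f (suc N)) (sumTo-suc f N)) (+-assoc (f 0) _ _)

sumTo-+ : ∀ f g N → sumTo (λ k → f k + g k) N ≡ sumTo f N + sumTo g N
sumTo-+ f g zero    = refl
sumTo-+ f g (suc N) = trans (cong (_+ (f N + g N)) (sumTo-+ f g N)) (interchange (sumTo f N) (sumTo g N) (f N) (g N))
  where
  interchange : ∀ a b c d → a + b + (c + d) ≡ a + c + (b + d)
  interchange = solve-∀

particles-applyUpTo : ∀ h N → particles (applyUpTo h N) ≡ sumTo (occupancy ∘ h) N
particles-applyUpTo h zero    = refl
particles-applyUpTo h (suc N) =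
  trans (cong (_+_ (occupancy (h 0))) (particles-applyUpTo (h ∘ suc) N)) (sym (sumTo-suc (occupancy ∘ h) N))

energy-applyUpTo : ∀ h N → energy (applyUpTo h N) ≡ sumTo (λ k → k * occupancy (h k)) N
energy-applyUpTo h zero    = refl
energy-applyUpTo h (suc N) = begin
  particles (applyUpTo (h ∘ suc) N) + energy (applyUpTo (h ∘ suc) N)
    ≡⟨ cong₂ _+_ (particles-applyUpTo (h ∘ suc) N) (energy-applyUpTo (h ∘ suc) N) ⟩
  sumTo (occupancy ∘ h ∘ suc) N + sumTo (λ k → k * occupancy (h (suc k))) N
    ≡⟨ sym (sumTo-+ (occupancy ∘ h ∘ suc) (λ k → k * occupancy (h (suc k))) N) ⟩
  sumTo (λ k → suc k * occupancy (h (suc k))) N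
    ≡⟨ sym (sumTo-suc (λ k → k * occupancy (h k)) N) ⟩
  sumTo (λ k → k * occupancy (h k)) (suc N) ∎
  where open ≡-Reasoning

cellAt-applyUpTo : ∀ h N k → k < N → cellAt (applyUpTo h N) k ≡ h k
cellAt-applyUpTo h (suc N) zero    _         = refl
cellAt-applyUpTo h (suc N) (suc k) (s≤s k<N) = cellAt-applyUpTo (h ∘ suc) N k k<N

cellAt-beyond : ∀ w k → length w ≤ k → cellAt w k ≡ vacant
cellAt-beyond []      k       _          = refl
cellAt-beyond (c ∷ w) (suc k) (s≤s w≤k) = cellAt-beyond w k w≤k

applyUpTo-cellAt : ∀ w → applyUpTo (cellAt w) (length w) ≡ w
applyUpTo-cellAt []      = refl
applyUpTo-cellAt (c ∷ w) = cong (c ∷_) (applyUpTo-cellAt w)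

Chain-cellAt : ∀ c w → Chain c w → Compatible c (cellAt w 0) × (∀ k → Compatible (cellAt w k) (cellAt w (suc k)))
Chain-cellAt c []      _                    = Compatible-vacant c , λ _ → tt
Chain-cellAt c (d ∷ w) (compatible , chain) with first , rest ← Chain-cellAt d w chain =
  compatible , λ { zero → first ; (suc k) → rest k }

cellAt-Chain : ∀ c w → Compatible c (cellAt w 0) → (∀ k → Compatible (cellAt w k) (cellAt w (suc k))) → Chain c w
cellAt-Chain c []      _     _    = tt
cellAt-Chain c (d ∷ w) first rest = first , cellAt-Chain d w (rest 0) (rest ∘ suc)

onX onY : Cell → Bool
onX (occupied rowX) = true
onX _               = false
onY (occupied rowY) = true
onY _               = false

toConfig : List Cell → Config
toConfig w (X (+ k))    = onX (cellAt w k)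
toConfig w (X -[1+ k ]) = false
toConfig w (Y (+ k))    = onY (cellAt w k)
toConfig w (Y -[1+ k ]) = true

toConfig-cong : ∀ {w w'} → cellAt w ≗ cellAt w' → toConfig w ≈ toConfig w'
toConfig-cong w≗w' (X (+ k))    = cong onX (w≗w' k)
toConfig-cong w≗w' (X -[1+ k ]) = refl
toConfig-cong w≗w' (Y (+ k))    = cong onY (w≗w' k)
toConfig-cong w≗w' (Y -[1+ k ]) = refl

onX-onY-injective : ∀ c c' → onX c ≡ onX c' → onY c ≡ onY c' → c ≡ c'
onX-onY-injective vacant          vacant          _  _  = refl
onX-onY-injective vacant          (occupied rowX) () _
onX-onY-injective vacant          (occupied rowY) _  ()
onX-onY-injective (occupied rowX) vacant          () _
onX-onY-injective (occupied rowX) (occupied rowX) _  _  = refl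
onX-onY-injective (occupied rowX) (occupied rowY) () _
onX-onY-injective (occupied rowY) vacant          _  ()
onX-onY-injective (occupied rowY) (occupied rowX) () _
onX-onY-injective (occupied rowY) (occupied rowY) _  _  = refl

toConfig-injective : ∀ {w w'} → toConfig w ≈ toConfig w' → cellAt w ≗ cellAt w'
toConfig-injective eq k = onX-onY-injective _ _ (eq (X (+ k))) (eq (Y (+ k)))

¬onX×onY : ∀ c → onX c ≡ true → onY c ≡ true → ⊥
¬onX×onY (occupied rowX) refl ()

Compatible⇒¬onX×onY : ∀ c d → Compatible c d → onX c ≡ true → onY d ≡ true → ⊥
Compatible⇒¬onX×onY (occupied rowX) (occupied rowY) () refl refl

Compatible⇒¬onY×onX : ∀ c d → Compatible c d → onY c ≡ true → onX d ≡ true → ⊥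
Compatible⇒¬onY×onX (occupied rowY) (occupied rowX) () refl refl

toConfig-independent : ∀ w → Chain (occupied rowY) w → Independent (toConfig w)
toConfig-independent w chain = independent
  where
  first : Compatible (occupied rowY) (cellAt w 0)
  first = proj₁ (Chain-cellAt _ w chain)
  next : ∀ k → Compatible (cellAt w k) (cellAt w (suc k))
  next = proj₂ (Chain-cellAt _ w chain)
  independent : ∀ u v → Edge u v → ¬ (toConfig w u ≡ true × toConfig w v ≡ true)
  independent _ _ (col (+ k))         (x , y) = ¬onX×onY (cellAt w k) x y
  independent _ _ (col -[1+ k ])      (() , _)
  independent _ _ (xy (+ k))          (x , y) =
    Compatible⇒¬onX×onY _ _ (next k) x (subst (λ i → onY (cellAt w i) ≡ true) (+-comm k 1) y)
  independent _ _ (xy -[1+ k ])       (() , _)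
  independent _ _ (yx (+ k))          (x , y) =
    Compatible⇒¬onY×onX _ _ (next k) y (subst (λ i → onX (cellAt w i) ≡ true) (+-comm k 1) x)
  independent _ _ (yx -[1+ zero ])    (x , _) = Compatible⇒¬onY×onX (occupied rowY) _ first refl x
  independent _ _ (yx -[1+ suc k ])   (() , _)

toConfig-beyond : ∀ w k → length w ≤ k → Occ (toConfig w) (+ k) ≡ false
toConfig-beyond w k w≤k rewrite cellAt-beyond w k w≤k = refl

toConfig-Cplus : ∀ w → Chain (occupied rowY) w → Cplus (toConfig w)
toConfig-Cplus w chain =
  toConfig-independent w chain , negative-occupied , (length w , toConfig-beyond w) , (-[1+ 0 ] , agrees-with-T)
  where
  negative-occupied : ∀ i → i ℤ.< + 0 → Occ (toConfig w) i ≡ true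
  negative-occupied -[1+ k ] _        = refl
  negative-occupied (+ k)    (+<+ ())
  agrees-with-T : ∀ i → i ℤ.≤ -[1+ 0 ] → toConfig w (X i) ≡ false × toConfig w (Y i) ≡ true
  agrees-with-T -[1+ k ] _ = refl , refl
  agrees-with-T (+ k)    ()

ind-occupancy : ∀ c → ind (onX c ∨ onY c) ≡ occupancy c
ind-occupancy vacant          = refl
ind-occupancy (occupied rowX) = refl
ind-occupancy (occupied rowY) = refl

toConfig-ChargeEnergy : ∀ w → ChargeEnergy (toConfig w) (particles w) (energy w)
toConfig-ChargeEnergy w = length w , toConfig-beyond w , charge , energy≡
  where
  charge : cntUpTo (toConfig w) (length w) ≡ particles w
  charge = begin
    sumTo (λ k → ind (Occ (toConfig w) (+ k))) (length w) ≡⟨ sumTo-cong (length w) (ind-occupancy ∘ cellAt w) ⟩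
    sumTo (occupancy ∘ cellAt w) (length w)               ≡⟨ sym (particles-applyUpTo (cellAt w) (length w)) ⟩
    particles (applyUpTo (cellAt w) (length w))           ≡⟨ cong particles (applyUpTo-cellAt w) ⟩
    particles w                                           ∎
    where open ≡-Reasoning
  energy≡ : enUpTo (toConfig w) (length w) ≡ energy w
  energy≡ = begin
    sumTo (λ k → k * ind (Occ (toConfig w) (+ k))) (length w)
      ≡⟨ sumTo-cong (length w) (λ k → cong (k *_) (ind-occupancy (cellAt w k))) ⟩
    sumTo (λ k → k * occupancy (cellAt w k)) (length w)
      ≡⟨ sym (energy-applyUpTo (cellAt w) (length w)) ⟩
    energy (applyUpTo (cellAt w) (length w))
      ≡⟨ cong energy (applyUpTo-cellAt w) ⟩
    energy w ∎
    where open ≡-Reasoning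

readCell : Bool → Bool → Cell
readCell true  _     = occupied rowX
readCell false true  = occupied rowY
readCell false false = vacant

columnCell : Config → ℤ → Cell
columnCell χ i = readCell (χ (X i)) (χ (Y i))

window : Config → ℕ → List Cell
window χ N = applyUpTo (columnCell χ ∘ +_) N

onX-readCell : ∀ a b → onX (readCell a b) ≡ a
onX-readCell true  b     = refl
onX-readCell false true  = refl
onX-readCell false false = refl

onY-readCell : ∀ a b → ¬ (a ≡ true × b ≡ true) → onY (readCell a b) ≡ b
onY-readCell true  true  ¬both = ⊥-elim (¬both (refl , refl))
onY-readCell true  false ¬both = refl
onY-readCell false true  ¬both = refl
onY-readCell false false ¬both = refl

ind-readCell : ∀ a b → ind (a ∨ b) ≡ occupancy (readCell a b)
ind-readCell true  b     = refl
ind-readCell false true  = refl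
ind-readCell false false = refl

readCell-Compatible : ∀ a b a' b' → ¬ (a ≡ true × b' ≡ true) → ¬ (b ≡ true × a' ≡ true) →
  Compatible (readCell a b) (readCell a' b')
readCell-Compatible true  b     true  b'    ¬xy ¬yx = refl
readCell-Compatible true  b     false true  ¬xy ¬yx = ⊥-elim (¬xy (refl , refl))
readCell-Compatible true  b     false false ¬xy ¬yx = tt
readCell-Compatible false true  true  b'    ¬xy ¬yx = ⊥-elim (¬yx (refl , refl))
readCell-Compatible false true  false true  ¬xy ¬yx = refl
readCell-Compatible false true  false false ¬xy ¬yx = tt
readCell-Compatible false false a'    b'    ¬xy ¬yx = tt

AgreesWithT : Config → ℤ → Set
AgreesWithT χ i = χ (X i) ≡ false × χ (Y i) ≡ true

-- Far-left agreement with T propagates rightwards: y_{i-1} blocks x_i, and column i must be occupied.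
Cplus-negative : ∀ {χ} → Cplus χ → ∀ j → AgreesWithT χ -[1+ j ]
Cplus-negative {χ} (independent , negative-occupied , _ , M , far-left) = from-bound M far-left
  where
  step : ∀ j → AgreesWithT χ -[1+ suc j ] → AgreesWithT χ -[1+ j ]
  step j (_ , y) with χ (X -[1+ j ]) in x
  ... | true  = ⊥-elim (independent _ _ (yx -[1+ suc j ]) (x , y))
  ... | false = refl , trans (sym (cong (_∨ χ (Y -[1+ j ])) x)) (negative-occupied -[1+ j ] -<+)
  descend : ∀ d j → AgreesWithT χ -[1+ d + j ] → AgreesWithT χ -[1+ j ]
  descend zero    j agrees = agrees
  descend (suc d) j agrees = descend d j (step (d + j) agrees)
  from-bound : ∀ M → (∀ i → i ℤ.≤ M → AgreesWithT χ i) → ∀ j → AgreesWithT χ -[1+ j ]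
  from-bound (+ m)      far-left j = far-left -[1+ j ] -≤+
  from-bound -[1+ m ]   far-left j = descend m j (far-left -[1+ m + j ] (-≤- (m≤m+n m j)))

module _ {χ : Config} (cplus : Cplus χ) {N : ℕ} (beyond : ∀ k → N ≤ k → Occ χ (+ k) ≡ false) where

  private
    independent : Independent χ
    independent = proj₁ cplus

  window-cellAt : ∀ k → cellAt (window χ N) k ≡ columnCell χ (+ k)
  window-cellAt k with k <? N
  ... | yes k<N = cellAt-applyUpTo _ N k k<N
  ... | no  k≮N = trans (cellAt-beyond (window χ N) k (subst (_≤ k) (sym (length-applyUpTo _ N)) N≤k))
                        (sym (cong₂ readCell (∨-conicalˡ _ _ empty) (∨-conicalʳ _ _ empty)))
    where
    N≤k : N ≤ k
    N≤k = ≮⇒≥ k≮N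
    empty : Occ χ (+ k) ≡ false
    empty = beyond k N≤k

  window-toConfig : χ ≈ toConfig (window χ N)
  window-toConfig (X (+ k))    = sym (trans (cong onX (window-cellAt k)) (onX-readCell _ _))
  window-toConfig (X -[1+ k ]) = proj₁ (Cplus-negative cplus k)
  window-toConfig (Y (+ k))    =
    sym (trans (cong onY (window-cellAt k)) (onY-readCell _ _ (independent _ _ (col (+ k)))))
  window-toConfig (Y -[1+ k ]) = proj₂ (Cplus-negative cplus k)

  window-Chain : Chain (occupied rowY) (window χ N)
  window-Chain = cellAt-Chain _ _ first next
    where
    first : Compatible (occupied rowY) (cellAt (window χ N) 0)
    first rewrite window-cellAt 0 = readCell-Compatible false true _ _ (λ ())
      (λ { (_ , x) → independent _ _ (yx -[1+ 0 ]) (x , proj₂ (Cplus-negative cplus 0)) })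
    next : ∀ k → Compatible (cellAt (window χ N) k) (cellAt (window χ N) (suc k))
    next k rewrite window-cellAt k | window-cellAt (suc k) = readCell-Compatible _ _ _ _
      (λ { (x , y) → independent _ _ (xy (+ k)) (x , subst (λ i → χ (Y (+ i)) ≡ true) (sym (+-comm k 1)) y) })
      (λ { (y , x) → independent _ _ (yx (+ k)) (subst (λ i → χ (X (+ i)) ≡ true) (sym (+-comm k 1)) x , y) })

  particles-window : particles (window χ N) ≡ cntUpTo χ N
  particles-window = trans (particles-applyUpTo _ N) (sumTo-cong N (λ k → sym (ind-readCell _ _)))

  energy-window : energy (window χ N) ≡ enUpTo χ N
  energy-window = trans (energy-applyUpTo _ N) (sumTo-cong N (λ k → cong (k *_) (sym (ind-readCell _ _))))

encoding : ∀ n → Gaps n → Config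
encoding n v = toConfig (encode n rowY v)

encoding-Cplus : ∀ n v → Cplus (encoding n v) × ChargeEnergy (encoding n v) n (triangle n + gapsWeight n v)
encoding-Cplus n v =
  toConfig-Cplus _ (Chain-encode n rowY v) ,
  subst₂ (ChargeEnergy (encoding n v)) (particles-encode n rowY v) (energy-encode n rowY v) (toConfig-ChargeEnergy (encode n rowY v))

encoding-injective : ∀ n v v' → encoding n v ≈ encoding n v' → v ≡ v'
encoding-injective n v v' = encode-injective n rowY v v' ∘ toConfig-injective

encoding-onto : ∀ {χ n m} → Cplus χ → ChargeEnergy χ n m →
  Σ (Gaps n) λ v → triangle n + gapsWeight n v ≡ m × χ ≈ encoding n v
encoding-onto {χ} {n} cplus (N , beyond , charge , energy≡)
  with v , encode≗window , energy-window≡ ←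
       encode-onto n rowY (window χ N) (window-Chain cplus beyond) (trans (particles-window cplus beyond) charge) =
  v , trans (sym energy-window≡) (trans (energy-window cplus beyond) energy≡) ,
  λ u → trans (window-toConfig cplus beyond u) (toConfig-cong (sym ∘ encode≗window) u)

lemma1 : (n m : ℕ) → HasCount (λ χ → Cplus χ × ChargeEnergy χ n m) (rhsCoeff n m)
lemma1 n m =
  Counted-map {_∼_ = _≈_} (encoding n ∘ proj₂)
    (λ { (_ , v) refl → encoding-Cplus n v })
    (λ { (tt , v) (tt , v') eq → cong (tt ,_) (encoding-injective n v v' eq) })
    (λ { χ (cplus , charge-energy) → let v , weight , χ≈ = encoding-onto cplus charge-energy in (tt , v) , weight , χ≈ })
    (HasSeries-rhsCoeff n m)
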